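{- Let $\sigma\ge 1$. If $\sigma$-FIFO is a $\sigma$-speed optimal algorithm for C-WGP (i.e. on every instance its maximum completion time is at most the optimal maximum completion time of an ordinary unit-speed schedule), then $\sigma$-FIFO is also a $\sigma$-speed optimal algorithm for F-WGP (i.e. on every instance its maximum flow time is at most the optimal maximum flow time of an ordinary unit-speed schedule).
   Context: The Wireless Gathering Problem (WGP). An instance consists of a finite connected undirected graph $G=(V,E)$, a sink node $s\in V$, a positive integer $d_I$ (interference radius), and a set of packets $J=\{1,\dots,m\}$; each packet $j$ has an origin $o_j\in V$ and a release date $r_j\in\mathbb{Z}_{\ge 0}$. Time is divided into rounds $0,1,2,\dots$. In a round, if $u,v$ are adjacent, $u$ may send a packet it currently holds to $v$; this is a call $(u,v)$. Let $d(u,v)$ be the shortest-path distance in $G$. Two calls $(u,v)$ and $(u',v')$ in the same round interfere if $d(u',v)\le d_I$ or $d(u,v')\le d_I$; otherwise they are compatible. A feasible schedule specifies, for each round, a set of pairwise compatible calls, each moving one packet, such that every packet exists in a unique copy, packet $j$ is not sent before its release date, and every packet eventually reaches $s$. The completion time $C_j$ is the time at which packet $j$ arrives at $s$ (a packet sent in round $t$ is at its new node at time $t+1$) and the flow time is $F_j=C_j-r_j$. C-WGP minimizes $\max_j C_j$, F-WGP minimizes $\max_j F_j$. Priority Greedy: each packet is given a unique priority; in every round, the available packets (released and not yet at $s$) are considered in order of decreasing priority, and each is sent from its current node to a neighbor one step closer to $s$, provided this call causes no interference with the calls already chosen in this round for higher-priority packets. FIFO is the Priority Greedy algorithm in which packets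 with earlier release dates have higher priority (ties broken arbitrarily). A $\sigma$-speed algorithm executes each round (a set of compatible calls) in $1/\sigma$ time units. $\sigma$-FIFO: (1) form instance $\mathcal{I}'$ from the given instance by setting release dates $r'_j=\sigma r_j$ (a packet may be sent in round $t$ of $\mathcal{I}'$ only if $t\ge \sigma r_j$); (2) run FIFO on $\mathcal{I}'$, obtaining completion times $C'_j$; (3) speed this schedule up by a factor $\sigma$, so round $t$ is executed at time $t/\sigma$ and packet $j$ has completion time $C_{j,\sigma}=C'_j/\sigma$ and flow time $F_{j,\sigma}=C_{j,\sigma}-r_j$. A $\sigma$-speed algorithm is $\sigma$-speed optimal for a problem if on every instance its cost is at most the optimal cost among ordinary (unit-speed) feasible schedules.
   Formalization: The speed factor σ of σ-FIFO ranges over the rationals. -}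

module Defs where

open import Data.Nat using (ℕ; zero; suc; _≤_; _<_)
open import Data.Fin using (Fin)
open import Data.Bool using (Bool; true)
open import Data.Maybe using (Maybe; just; nothing)
open import Data.Product using (Σ; ∃; _×_; _,_)
open import Data.Sum using (_⊎_)
open import Data.Integer using (+_)
open import Data.Rational using (ℚ; _/_) renaming (_≤_ to _≤ℚ_; _*_ to _*ℚ_)
open import Relation.Nullary using (¬_)
open import Relation.Binary.PropositionalEquality using (_≡_; _≢_)

ℕ→ℚ : ℕ → ℚ
ℕ→ℚ n = (+ n) / 1

record Instance : Set where
  field
    n       : ℕ
    adj     : Fin n → Fin n → Bool
    adj-sym : ∀ u v → adj u v ≡ true → adj v u ≡ true
    adj-irr : ∀ u → ¬ (adj u u ≡ true)
    sink    : Fin n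
    dI      : ℕ
    dI-pos  : 1 ≤ dI
    m       : ℕ
    origin  : Fin m → Fin n
    release : Fin m → ℕ

module _ (I : Instance) where
  open Instance I

  data Walk : Fin n → Fin n → ℕ → Set where
    here : ∀ {u} → Walk u u zero
    step : ∀ {u w v k} → adj u w ≡ true → Walk w v k → Walk u v (suc k)

  Connected : Set
  Connected = ∀ u v → ∃ λ k → Walk u v k

  Dist : Fin n → Fin n → ℕ → Set
  Dist u v k = Walk u v k × (∀ k' → Walk u v k' → k ≤ k')

  Interfere : Fin n → Fin n → Fin n → Fin n → Set
  Interfere u v u' v' =
    (∃ λ k → Dist u' v k × k ≤ dI) ⊎ (∃ λ k → Dist u v' k × k ≤ dI)

  Compatible : Fin n → Fin n → Fin n → Fin n → Set
  Compatible u v u' v' = ¬ Interfere u v u' v'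

  CloserNbr : Fin n → Fin n → Set
  CloserNbr u v = adj u v ≡ true × (∃ λ k → Dist v sink k × Dist u sink (suc k))

  next : Fin n → Maybe (Fin n) → Fin n
  next u (just v) = v
  next u nothing  = u

  -- Ordinary (unit-speed) feasible schedules.
  -- pos t j = node holding packet j at time t; move t j = just v means
  -- that in round t packet j is sent from pos t j to v.
  record Schedule : Set where
    field
      pos      : ℕ → Fin m → Fin n
      move     : ℕ → Fin m → Maybe (Fin n)
      pos-init : ∀ j → pos zero j ≡ origin j
      pos-step : ∀ t j → pos (suc t) j ≡ next (pos t j) (move t j)
      move-ok  : ∀ t j v → move t j ≡ just v →
                 adj (pos t j) v ≡ true × release j ≤ t × pos t j ≢ sink
      compat   : ∀ t i j v w → i ≢ j → move t i ≡ just v → move t j ≡ just w →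
                 Compatible (pos t i) v (pos t j) w
      reaches  : ∀ j → ∃ λ t → pos t j ≡ sink

  CompletedBy : Schedule → Fin m → ℕ → Set
  CompletedBy S j T = Schedule.pos S T j ≡ sink

  -- Runs of FIFO on the instance I' with release dates σ·r_j.
  -- Priority: smaller prio value = higher priority; earlier (original)
  -- release dates (equivalently earlier σ·r_j, σ > 0) have higher
  -- priority, ties broken arbitrarily; neighbour choice arbitrary.
  record FIFORun (σ : ℚ) : Set where
    field
      prio     : Fin m → ℕ
      prio-inj : ∀ i j → prio i ≡ prio j → i ≡ j
      prio-fifo : ∀ i j → release i < release j → prio i < prio j
      pos      : ℕ → Fin m → Fin n
      move     : ℕ → Fin m → Maybe (Fin n)
      pos-init : ∀ j → pos zero j ≡ origin j
      pos-step : ∀ t j → pos (suc t) j ≡ next (pos t j) (move t j)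

    Available : ℕ → Fin m → Set
    Available t j = (σ *ℚ ℕ→ℚ (release j)) ≤ℚ ℕ→ℚ t × pos t j ≢ sink

    HigherOK : ℕ → Fin m → Fin n → Fin n → Set
    HigherOK t j u v = ∀ i w → prio i < prio j → move t i ≡ just w →
                       Compatible (pos t i) w u v

    field
      greedy-send : ∀ t j v → move t j ≡ just v →
                    Available t j × CloserNbr (pos t j) v × HigherOK t j (pos t j) v
      greedy-wait : ∀ t j → move t j ≡ nothing → Available t j →
                    ∀ v → CloserNbr (pos t j) v → ¬ HigherOK t j (pos t j) v

-- σ-speed optimality of σ-FIFO.
-- Completion time of j in σ-FIFO is C'_j/σ where C'_j is the time (in I')
-- at which j reaches the sink; C'_j/σ ≤ K  ⟺  C'_j ≤ σ·K.

-- C-WGP: max_j C_{j,σ} ≤ optimal max completion time (i.e. ≤ the max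
-- completion time K of every feasible unit-speed schedule).
σFIFO-C-optimal : ℚ → Set
σFIFO-C-optimal σ =
  (I : Instance) → Connected I → (R : FIFORun I σ) → (S : Schedule I) → (K : ℕ) →
  (∀ j → CompletedBy I S j K) →
  ∀ j → ∃ λ t → FIFORun.pos R t j ≡ Instance.sink I × ℕ→ℚ t ≤ℚ (σ *ℚ ℕ→ℚ K)

-- F-WGP: max_j F_{j,σ} ≤ optimal max flow time, where F_j = C_j − r_j,
-- so "max flow of S ≤ K" is C_j ≤ r_j + K for all j.
σFIFO-F-optimal : ℚ → Set
σFIFO-F-optimal σ =
  (I : Instance) → Connected I → (R : FIFORun I σ) → (S : Schedule I) → (K : ℕ) →
  (∀ j → CompletedBy I S j (Instance.release I j Data.Nat.+ K)) →
  ∀ j → ∃ λ t → FIFORun.pos R t j ≡ Instance.sink I ×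
        ℕ→ℚ t ≤ℚ (σ *ℚ ℕ→ℚ (Instance.release I j Data.Nat.+ K))

module Submission where

-- Fix a run R of σ-FIFO,
-- a unit-speed schedule S of maximum flow time ≤ K, and a packet j₀.
-- Delete every packet of lower FIFO priority than j₀, i.e. move its
-- origin to the sink so that it is never sent.  Then:
--   * Priority Greedy never lets a packet be disturbed by packets of lower
--     priority, so the calls of R for the remaining packets form a σ-FIFO
--     run R₀ of the reduced instance, and j₀ travels exactly as in R;
--   * the remaining packets have release dates ≤ r_{j₀} (FIFO priorities
--     respect release dates), so S restricted to them is a feasible
--     schedule completing all packets by time r_{j₀} + K.
-- C-optimality applied to R₀ and the restricted S gives
-- C_{j₀,σ} ≤ r_{j₀} + K, which is F_{j₀,σ} ≤ K.

open import Defs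
open import Data.Rational using (ℚ; 1ℚ; _≤_) renaming (_*_ to _*ℚ_)
open import Data.Nat as ℕ using (ℕ; zero; suc; _+_; _≤′_; ≤′-refl; ≤′-step)
open import Data.Nat.Properties
  using (≤-trans; <⇒≤; <⇒≱; ≮⇒≥; ≤⇒≤′; +-monoˡ-≤; ≤-refl)
open import Data.Bool using (true; if_then_else_)
open import Data.Fin using (Fin)
open import Data.Maybe using (Maybe; just; nothing)
open import Data.Product using (∃; _×_; _,_; proj₂)
open import Data.Sum using (inj₁; inj₂)
open import Data.Empty using (⊥-elim)
open import Relation.Nullary using (¬_; Dec; yes; no; does; contradiction)
open import Relation.Binary.PropositionalEquality
  using (_≡_; _≢_; refl; sym; trans; cong)

module Reorigin (I : Instance) (o : Fin (Instance.m I) → Fin (Instance.n I)) where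
  open Instance I

  I' : Instance
  I' = record I { origin = o }

  walk→ : ∀ {u v k} → Walk I u v k → Walk I' u v k
  walk→ here       = here
  walk→ (step a w) = step a (walk→ w)

  walk← : ∀ {u v k} → Walk I' u v k → Walk I u v k
  walk← here       = here
  walk← (step a w) = step a (walk← w)

  connected→ : Connected I → Connected I'
  connected→ conn u v with conn u v
  ... | k , w = k , walk→ w

  dist→ : ∀ {u v k} → Dist I u v k → Dist I' u v k
  dist→ (w , shortest) = walk→ w , λ k' w' → shortest k' (walk← w')

  dist← : ∀ {u v k} → Dist I' u v k → Dist I u v k
  dist← (w , shortest) = walk← w , λ k' w' → shortest k' (walk→ w')

  interfere→ : ∀ {u v u' v'} → Interfere I u v u' v' → Interfere I' u v u' v'
  interfere→ (inj₁ (k , d , k≤dI)) = inj₁ (k , dist→ d , k≤dI)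
  interfere→ (inj₂ (k , d , k≤dI)) = inj₂ (k , dist→ d , k≤dI)

  interfere← : ∀ {u v u' v'} → Interfere I' u v u' v' → Interfere I u v u' v'
  interfere← (inj₁ (k , d , k≤dI)) = inj₁ (k , dist← d , k≤dI)
  interfere← (inj₂ (k , d , k≤dI)) = inj₂ (k , dist← d , k≤dI)

  compatible→ : ∀ {u v u' v'} → Compatible I u v u' v' → Compatible I' u v u' v'
  compatible→ c x = c (interfere← x)

  compatible← : ∀ {u v u' v'} → Compatible I' u v u' v' → Compatible I u v u' v'
  compatible← c x = c (interfere→ x)

  closer→ : ∀ {u v} → CloserNbr I u v → CloserNbr I' u v
  closer→ (a , k , dv , du) = a , k , dist→ dv , dist→ du

  closer← : ∀ {u v} → CloserNbr I' u v → CloserNbr I u v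
  closer← (a , k , dv , du) = a , k , dist← dv , dist← du

  next-same : ∀ u mv → next I u mv ≡ next I' u mv
  next-same u (just v) = refl
  next-same u nothing  = refl

-- Keeping only the packets satisfying a decidable predicate P: the other
-- packets start at the sink (so they never move), and the kept packets
-- behave exactly as before.
module Restrict (I : Instance) {P : Fin (Instance.m I) → Set}
                (keep : ∀ i → Dec (P i)) where
  open Instance I

  keepOr : {A : Set} → Fin m → A → A → A
  keepOr i a b = if does (keep i) then a else b

  open Reorigin I (λ i → keepOr i (origin i) sink) public

  nothing≢just : ∀ {A : Set} {a : A} → nothing ≢ just a
  nothing≢just ()

  -- A feasible schedule remains feasible when the removed packets are
  -- parked at the sink: fewer calls cannot create interference.
  restrictSchedule : Schedule I → Schedule I'
  restrictSchedule S = record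
    { pos      = pos'
    ; move     = move'
    ; pos-init = pos-init'
    ; pos-step = pos-step'
    ; move-ok  = move-ok'
    ; compat   = compat'
    ; reaches  = reaches'
    }
    where
    module S = Schedule S

    pos' : ℕ → Fin m → Fin n
    pos' t i = keepOr i (S.pos t i) sink

    move' : ℕ → Fin m → Maybe (Fin n)
    move' t i = keepOr i (S.move t i) nothing

    pos-init' : ∀ i → pos' zero i ≡ Instance.origin I' i
    pos-init' i with keep i
    ... | yes _ = S.pos-init i
    ... | no  _ = refl

    pos-step' : ∀ t i → pos' (suc t) i ≡ next I' (pos' t i) (move' t i)
    pos-step' t i with keep i
    ... | yes _ = trans (S.pos-step t i) (next-same (S.pos t i) (S.move t i))
    ... | no  _ = refl

    move-ok' : ∀ t i v → move' t i ≡ just v →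
               adj (pos' t i) v ≡ true × release i ℕ.≤ t × pos' t i ≢ sink
    move-ok' t i v mv with keep i
    ... | yes _ = S.move-ok t i v mv
    ... | no  _ = ⊥-elim (nothing≢just mv)

    compat' : ∀ t i j v w → i ≢ j → move' t i ≡ just v → move' t j ≡ just w →
              Compatible I' (pos' t i) v (pos' t j) w
    compat' t i j v w i≢j mvi mvj with keep i | keep j
    ... | yes _ | yes _ = compatible→ (S.compat t i j v w i≢j mvi mvj)
    ... | no  _ | _     = ⊥-elim (nothing≢just mvi)
    ... | yes _ | no  _ = ⊥-elim (nothing≢just mvj)

    reaches' : ∀ i → ∃ λ t → pos' t i ≡ sink
    reaches' i with keep i
    ... | yes _ = S.reaches i
    ... | no  _ = zero , refl

  restrictSchedule-completed : (S : Schedule I) (T : ℕ) →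
    (∀ i → P i → CompletedBy I S i T) → ∀ i → CompletedBy I' (restrictSchedule S) i T
  restrictSchedule-completed S T done i with keep i
  ... | yes p = done i p
  ... | no  _ = refl

  -- If the kept packets are closed under higher priority, then the run
  -- restricted to them is again a Priority Greedy (FIFO) run: a kept packet
  -- only ever competes with higher-priority packets, which are all kept.
  module _ {σ : ℚ} (R : FIFORun I σ)
           (closed : ∀ i j → FIFORun.prio R i ℕ.< FIFORun.prio R j → P j → P i) where
    private module R = FIFORun R

    pos' : ℕ → Fin m → Fin n
    pos' t i = keepOr i (R.pos t i) sink

    move' : ℕ → Fin m → Maybe (Fin n)
    move' t i = keepOr i (R.move t i) nothing

    Available' : ℕ → Fin m → Set
    Available' t j = (σ *ℚ ℕ→ℚ (release j)) ≤ ℕ→ℚ t × pos' t j ≢ sink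

    HigherOK' : ℕ → Fin m → Fin n → Fin n → Set
    HigherOK' t j u v = ∀ i w → R.prio i ℕ.< R.prio j → move' t i ≡ just w →
                        Compatible I' (pos' t i) w u v

    higherOK→ : ∀ {t j u v} → R.HigherOK t j u v → HigherOK' t j u v
    higherOK→ ok i w lt mv with keep i
    ... | yes _ = compatible→ (ok i w lt mv)
    ... | no  _ = ⊥-elim (nothing≢just mv)

    higherOK← : ∀ {t j u v} → P j → HigherOK' t j u v → R.HigherOK t j u v
    higherOK← {t} {j} pj ok i w lt mv with keep i | ok i w lt
    ... | yes _ | ok-i = compatible← (ok-i mv)
    ... | no ¬pi | _   = contradiction (closed i j lt pj) ¬pi

    restrictRun : FIFORun I' σ
    restrictRun = record
      { prio        = R.prio
      ; prio-inj    = R.prio-inj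
      ; prio-fifo   = R.prio-fifo
      ; pos         = pos'
      ; move        = move'
      ; pos-init    = pos-init'
      ; pos-step    = pos-step'
      ; greedy-send = greedy-send'
      ; greedy-wait = greedy-wait'
      }
      where
      pos-init' : ∀ i → pos' zero i ≡ Instance.origin I' i
      pos-init' i with keep i
      ... | yes _ = R.pos-init i
      ... | no  _ = refl

      pos-step' : ∀ t i → pos' (suc t) i ≡ next I' (pos' t i) (move' t i)
      pos-step' t i with keep i
      ... | yes _ = trans (R.pos-step t i) (next-same (R.pos t i) (R.move t i))
      ... | no  _ = refl

      greedy-send' : ∀ t j v → move' t j ≡ just v →
        Available' t j × CloserNbr I' (pos' t j) v × HigherOK' t j (pos' t j) v
      greedy-send' t j v mv with keep j
      ... | no  _ = ⊥-elim (nothing≢just mv)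
      ... | yes _ with R.greedy-send t j v mv
      ...   | available , closer , ok = available , closer→ closer , higherOK→ ok

      greedy-wait' : ∀ t j → move' t j ≡ nothing → Available' t j →
        ∀ v → CloserNbr I' (pos' t j) v → ¬ HigherOK' t j (pos' t j) v
      greedy-wait' t j mv (released , notAtSink) v closer ok with keep j
      ... | no  _  = notAtSink refl
      ... | yes pj = R.greedy-wait t j mv (released , notAtSink) v
                       (closer← closer) (higherOK← pj ok)

    restrictRun-pos : ∀ {i} t → P i → pos' t i ≡ R.pos t i
    restrictRun-pos {i} t pi with keep i
    ... | yes _  = refl
    ... | no ¬pi = contradiction pi ¬pi

-- In a feasible schedule a packet at the sink stays there: it cannot be
-- sent, since calls are only made from nodes other than the sink.
stays-at-sink : (I : Instance) (S : Schedule I) (j : Fin (Instance.m I)) (t : ℕ) →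
                CompletedBy I S j t → CompletedBy I S j (suc t)
stays-at-sink I S j t atSink with Schedule.move S t j in mv
... | nothing = trans (Schedule.pos-step S t j) (trans (cong (next I _) mv) atSink)
... | just v  = contradiction atSink (proj₂ (proj₂ (Schedule.move-ok S t j v mv)))

completedBy-mono : (I : Instance) (S : Schedule I) (j : Fin (Instance.m I)) {T T' : ℕ} →
                   T ≤′ T' → CompletedBy I S j T → CompletedBy I S j T'
completedBy-mono I S j ≤′-refl       done = done
completedBy-mono I S j (≤′-step le) done = stays-at-sink I S j _ (completedBy-mono I S j le done)

fifo-release : {I : Instance} {σ : ℚ} (R : FIFORun I σ) (i j : Fin (Instance.m I)) →
               FIFORun.prio R i ℕ.≤ FIFORun.prio R j →
               Instance.release I i ℕ.≤ Instance.release I j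
fifo-release R i j prio≤ = ≮⇒≥ (λ later → <⇒≱ (FIFORun.prio-fifo R j i later) prio≤)

module FlowToCompletion {σ : ℚ} (I : Instance) (R : FIFORun I σ)
                        (j₀ : Fin (Instance.m I)) where
  open Instance I

  keep : ∀ i → Dec (FIFORun.prio R i ℕ.≤ FIFORun.prio R j₀)
  keep i = FIFORun.prio R i ℕ.≤? FIFORun.prio R j₀

  open Restrict I keep public renaming (I' to I₀)

  kept-closed : ∀ i j → FIFORun.prio R i ℕ.< FIFORun.prio R j →
                FIFORun.prio R j ℕ.≤ FIFORun.prio R j₀ → FIFORun.prio R i ℕ.≤ FIFORun.prio R j₀
  kept-closed i j higher j-kept = ≤-trans (<⇒≤ higher) j-kept

  R₀ : FIFORun I₀ σ
  R₀ = restrictRun R kept-closed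

  R₀-arrival : ∀ t → FIFORun.pos R₀ t j₀ ≡ sink → FIFORun.pos R t j₀ ≡ sink
  R₀-arrival t = trans (sym (restrictRun-pos R kept-closed t ≤-refl))

  -- If S has maximum flow time ≤ K, its restriction completes all packets
  -- by r_{j₀} + K, because every kept packet i has r_i ≤ r_{j₀}.
  restricted-completion : (S : Schedule I) (K : ℕ) →
    (∀ j → CompletedBy I S j (release j + K)) →
    ∀ j → CompletedBy I₀ (restrictSchedule S) j (release j₀ + K)
  restricted-completion S K flow≤K = restrictSchedule-completed S (release j₀ + K) λ i kept →
    completedBy-mono I S i (≤⇒≤′ (+-monoˡ-≤ K (fifo-release R i j₀ kept))) (flow≤K i)

lemma4p5 : (σ : ℚ) → 1ℚ ≤ σ → σFIFO-C-optimal σ → σFIFO-F-optimal σ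
lemma4p5 σ _ C-optimal I conn R S K flow≤K j₀ =
  let (t , atSink , onTime) =
        C-optimal I₀ (connected→ conn) R₀ (restrictSchedule S) (release j₀ + K)
                  (restricted-completion S K flow≤K) j₀
  in t , R₀-arrival t atSink , onTime
  where
  open Instance I using (release)
  open FlowToCompletion I R j₀
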